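{- Let $N\ge1$ be an integer and let $\mathcal{A}(N)$ be an optimal partition of $\{1,\dots,N\}$ into paths of the divisor graph. (i) Let $1\le n\le N$ be an integer that is factorizing for $\mathcal{A}(N)$, and let $k=\lfloor N/n\rfloor$. Then there are exactly $F(k)$ paths in $\mathcal{A}(N)$ that contain a multiple of $n$, and they are of the form $n\mathcal{D}_1, n\mathcal{D}_2,\dots,n\mathcal{D}_{F(k)}$, where $\mathcal{D}_1,\dots,\mathcal{D}_{F(k)}$ is an optimal partition of $\{1,2,\dots,k\}$ into paths. (ii) Let $z>1$ be a real number and let $M_z(N)$ be the set of integers $m\le N$ that are not factorizing for $\mathcal{A}(N)$ and satisfy $m>N/z$ and $P^-(m)>z$. Then $|M_z(N)|<\frac{2N}{z}$.
   Context: The divisor graph is the undirected graph whose vertices are the positive integers, with an edge $\{a,b\}$ whenever $a<b$ and $a$ divides $b$. A path of integers $\le N$ is a tuple $(a_1,\dots,a_l)$ of pairwise distinct positive integers $\le N$ such that for each $1\le i<l$, $a_i$ divides $a_{i+1}$ or $a_{i+1}$ divides $a_i$ (paths are taken up to reversal). For real $x\ge1$, $F(x)$ is the minimal number of paths in a partition of $\{1,\dots,\lfloor x\rfloor\}$ into such paths; a partition with exactly $F(x)$ paths is optimal. For a path $\mathcal{D}=(d_1,\dots,d_l)$ and an integer $n$, $n\mathcal{D}$ denotes the path $(nd_1,\dots,nd_l)$. A path is $n$-factorizable if all its integers are multiples of $n$. An integer $1\le n\le N$ is factorizing for a partition $\mathcal{A}(N)$ of $\{1,\dots,N\}$ into paths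 if every path of $\mathcal{A}(N)$ containing a multiple of $n$ is $n$-factorizable. For an integer $m\ge2$, $P^-(m)$ is the smallest prime factor of $m$.
   Formalization: In part (ii) the parameter z ranges over the rationals greater than 1 rather than over all real numbers $z>1$. -}

module Defs where

open import Data.Nat using (ℕ; suc; _≤_; _<_; _*_)
open import Data.Nat.Divisibility using (_∣_; _∣?_)
open import Data.Nat.Primality using (Prime)
open import Data.List using (List; []; map; concat; upTo; length; filter)
open import Data.List.Relation.Unary.All using (All)
open import Data.List.Relation.Unary.Any using (Any; any?)
open import Data.List.Relation.Unary.Linked using (Linked)
open import Data.List.Relation.Unary.Unique.Propositional using (Unique)
open import Data.List.Relation.Binary.Permutation.Propositional using (_↭_)
open import Data.List.Membership.Propositional using (_∈_)
open import Data.Product using (_×_)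
open import Data.Sum using (_⊎_)
open import Relation.Nullary using (¬_)
open import Relation.Binary.PropositionalEquality using (_≢_)

range1 : ℕ → List ℕ
range1 N = map suc (upTo N)

Adj : ℕ → ℕ → Set
Adj a b = a ∣ b ⊎ b ∣ a

IsPath : ℕ → List ℕ → Set
IsPath N xs = (xs ≢ []) × Unique xs × All (λ a → 1 ≤ a × a ≤ N) xs × Linked Adj xs

IsPartition : ℕ → List (List ℕ) → Set
IsPartition N P = All (IsPath N) P × (concat P ↭ range1 N)

-- optimal partition: minimal number of paths (its length is F(N))
IsOptimal : ℕ → List (List ℕ) → Set
IsOptimal N P = IsPartition N P × (∀ Q → IsPartition N Q → length P ≤ length Q)

scale : ℕ → List ℕ → List ℕ
scale n D = map (n *_) D

Factorizing : List (List ℕ) → ℕ → Set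
Factorizing A n = ∀ P → P ∈ A → Any (n ∣_) P → All (n ∣_) P

pathsWithMultiple : ℕ → List (List ℕ) → List (List ℕ)
pathsWithMultiple n A = filter (λ P → any? (n ∣?_) P) A

SmallestPrimeFactor : ℕ → ℕ → Set
SmallestPrimeFactor m p = Prime p × p ∣ m × (∀ q → Prime q → q ∣ m → p ≤ q)

-- membership in M_z(N) for z = zn / zd (zd ≥ 1):
-- m ≤ N, m not factorizing, m > N/z, P⁻(m) > z
InM : ℕ → List (List ℕ) → ℕ → ℕ → ℕ → Set
InM N A zn zd m =
  m ≤ N × ¬ Factorizing A m × N * zd < m * zn ×
  (2 ≤ m × (∀ p → SmallestPrimeFactor m p → zn < p * zd))

{-# OPTIONS --safe #-}
module Submission where

-- (i) When n is factorizing, the paths of A(N) meeting a multiple of n consist of multiples of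
-- n only, so together they contain exactly n, 2n, …, kn with k = ⌊N/n⌋; dividing them by n
-- gives a partition D of {1,…,k}.  D is optimal: for any partition Q of {1,…,k}, replacing
-- those paths by nQ gives a partition of {1,…,N}, which cannot have fewer paths than A(N).
--
-- (ii) For a non-factorizing m some path contains both a multiple and a non-multiple of m,
-- hence consecutive entries y ∣ x with m ∣ x and m ∤ y.  All divisors d > 1 of m
-- exceed z, and gcd(m, x/y) > 1, so x/y > z and y < N/z.  Moreover x has only one divisor
-- m > N/z whose divisors d > 1 all exceed z.  As y has at most one successor and one
-- predecessor in the partition, m ↦ (y, side of y on which x lies) is injective into
-- {y < N/z} × {left, right}, and |M_z(N)| < 2N/z.

open import Defs
open import Data.Bool using (Bool; true; false)
open import Data.List using (List; []; _∷_; _++_; length; map; concat; concatMap; upTo; filter)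
open import Data.List.Membership.Propositional using (_∈_; find)
open import Data.List.Membership.Propositional.Properties
open import Data.List.Membership.Propositional.Properties.WithK using (unique∧set⇒bag)
open import Data.List.Properties
  using (length-map; length-++; length-upTo; map-∘; map-id-local; map-++; concat-map; concat-++; partition-defn)
open import Data.List.Relation.Binary.BagAndSetEquality using (∼bag⇒↭; ↭⇒∼bag; concat-cong)
open import Data.List.Relation.Binary.Permutation.Propositional
  using (_↭_; ↭-sym; ↭-trans; ↭-reflexive; ↭ₛ⇒↭; ↭⇒↭ₛ; module PermutationReasoning)
import Data.List.Relation.Binary.Permutation.Propositional.Properties as Perm
import Data.List.Relation.Binary.Permutation.Setoid.Properties as PermSetoid
open import Data.List.Relation.Binary.Sublist.Propositional using (_⊆_; []; _∷_; _∷ʳ_; ⊆-refl)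
import Data.List.Relation.Binary.Sublist.Propositional.Properties as Sublist
open import Data.List.Relation.Unary.All as All using (All; []; _∷_)
import Data.List.Relation.Unary.All.Properties as All
open import Data.List.Relation.Unary.All.Properties.Core using (¬All⇒Any¬)
open import Data.List.Relation.Unary.AllPairs using (_∷_)
open import Data.List.Relation.Unary.Any as Any using (Any; here; there; any?)
open import Data.List.Relation.Unary.Linked as Linked using (Linked; []; [-]; _∷_)
import Data.List.Relation.Unary.Linked.Properties as Linked
open import Data.List.Relation.Unary.Unique.Propositional using (Unique)
import Data.List.Relation.Unary.Unique.Propositional.Properties as Unique
open import Data.Nat
  using (ℕ; zero; suc; pred; _+_; _≤_; _<_; _*_; _/_; NonZero; z≤n; s≤s;
         >-nonZero; >-nonZero⁻¹; ≢-nonZero⁻¹; n>1⇒nonTrivial; nonTrivial⇒n>1)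
open import Data.Nat.Coprimality using (gcd≡1⇒coprime; coprime-divisor)
open import Data.Nat.Divisibility
  using (_∣_; _∣?_; divides; 0∣⇒≡0; m∣m*n; *-monoʳ-∣; *-cancelˡ-∣; ∣-refl; ∣-trans; ∣-antisym;
         ∣⇒≤)
open import Data.Nat.Divisibility.Core using (hasNonTrivialDivisor)
open import Data.Nat.DivMod using (m*n/n≡m; m*[n/m]≡n; /-monoˡ-≤; m/n*n≤m)
open import Data.Nat.GCD using (gcd; gcd[m,n]∣m; gcd[m,n]∣n; gcd[m,n]≡0⇒n≡0)
open import Data.Nat.Primality using (_Rough_; 2-rough; ∤⇒rough-suc; rough∧∣⇒prime; prime⇒nonTrivial)
open import Data.Nat.Properties
open import Data.Product using (_×_; _,_; Σ; ∃₂; ∃-syntax; proj₁; proj₂; uncurry; swap)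
open import Data.Sum as Sum using (_⊎_; inj₁; inj₂)
open import Function using (_∘_; id; const)
open import Function.Bundles using (_⇔_; mk⇔; Equivalence)
open import Relation.Binary.PropositionalEquality
  using (_≡_; refl; sym; trans; cong; cong₂; subst; subst₂; setoid; module ≡-Reasoning)
open import Relation.Nullary using (¬_; yes; no; contradiction)
open import Relation.Nullary.Decidable using (toSum; _→-dec_)
open import Relation.Unary using (Pred; Decidable; ∁)
open import Relation.Unary.Properties using (∁?)

open Equivalence using (to; from)

module _ {a} {A : Set a} where

  Unique-resp-↭ : {xs ys : List A} → xs ↭ ys → Unique xs → Unique ys
  Unique-resp-↭ xs↭ys = PermSetoid.Unique-resp-↭ (setoid A) (↭⇒↭ₛ xs↭ys)

  Unique-resp-⊆ : {xs ys : List A} → xs ⊆ ys → Unique ys → Unique xs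
  Unique-resp-⊆ []           unique        = unique
  Unique-resp-⊆ (_ ∷ʳ xs⊆)   (_ ∷ unique)  = Unique-resp-⊆ xs⊆ unique
  Unique-resp-⊆ (refl ∷ xs⊆) (x∉ ∷ unique) = Sublist.All-resp-⊆ xs⊆ x∉ ∷ Unique-resp-⊆ xs⊆ unique

  unique∧⇔⇒↭ : {xs ys : List A} → Unique xs → Unique ys → (∀ {x} → x ∈ xs ⇔ x ∈ ys) → xs ↭ ys
  unique∧⇔⇒↭ unique-xs unique-ys sameMembers = ∼bag⇒↭ (unique∧set⇒bag unique-xs unique-ys sameMembers)

  concat-↭ : {xss yss : List (List A)} → xss ↭ yss → concat xss ↭ concat yss
  concat-↭ xss↭yss = ∼bag⇒↭ (concat-cong (↭⇒∼bag xss↭yss))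

  filter-++-∁-↭ : ∀ {p} {P : Pred A p} (P? : Decidable P) xs → xs ↭ filter P? xs ++ filter (∁? P?) xs
  filter-++-∁-↭ P? xs = ↭-trans (↭ₛ⇒↭ (PermSetoid.partition-↭ (setoid A) P? xs))
                                 (↭-reflexive (cong (uncurry _++_) (partition-defn P? xs)))

module _ {a b} {A : Set a} {B : Set b} where

  Unique-map⇒injective : ∀ {f : A → B} {xs x y} → Unique (map f xs) →
                         x ∈ xs → y ∈ xs → f x ≡ f y → x ≡ y
  Unique-map⇒injective _ (here refl) (here refl) _ = refl
  Unique-map⇒injective {f} (fx∉ ∷ _) (here refl) (there y∈) fx≡fy =
    contradiction fx≡fy (All.lookup fx∉ (∈-map⁺ f y∈))
  Unique-map⇒injective {f} (fy∉ ∷ _) (there x∈) (here refl) fx≡fy =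
    contradiction (sym fx≡fy) (All.lookup fy∉ (∈-map⁺ f x∈))
  Unique-map⇒injective (_ ∷ unique) (there x∈) (there y∈) fx≡fy = Unique-map⇒injective unique x∈ y∈ fx≡fy

  pigeonhole : ∀ {r} (R : A → B → Set r) {xs ts} → Unique xs →
               (∀ {x} → x ∈ xs → ∃[ t ] t ∈ ts × R x t) →
               (∀ {x x′ t} → x ∈ xs → x′ ∈ xs → R x t → R x′ t → x ≡ x′) →
               length xs ≤ length ts
  pigeonhole R {[]} _ _ _ = z≤n
  pigeonhole R {x ∷ xs} (x∉ ∷ unique) image injective with image (here refl)
  ... | t , t∈ts , Rxt with ∈-∃++ t∈ts
  ... | ts₁ , ts₂ , refl = begin
    suc (length xs)          ≤⟨ s≤s (pigeonhole R unique image′ injective′) ⟩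
    length (t ∷ ts₁ ++ ts₂)  ≡⟨ Perm.↭-length (Perm.shift t ts₁ ts₂) ⟨
    length (ts₁ ++ t ∷ ts₂)  ∎
    where
    open ≤-Reasoning
    injective′ : ∀ {x x′ t} → x ∈ xs → x′ ∈ xs → R x t → R x′ t → x ≡ x′
    injective′ x∈ x′∈ = injective (there x∈) (there x′∈)
    image′ : ∀ {x′} → x′ ∈ xs → ∃[ t′ ] t′ ∈ ts₁ ++ ts₂ × R x′ t′
    image′ x′∈ with image (there x′∈)
    ... | t′ , t′∈ , Rx′t′ with ∈-++⁻ ts₁ t′∈
    ... | inj₁ t′∈ts₁         = t′ , ∈-++⁺ˡ t′∈ts₁ , Rx′t′
    ... | inj₂ (there t′∈ts₂) = t′ , ∈-++⁺ʳ ts₁ t′∈ts₂ , Rx′t′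
    ... | inj₂ (here refl)    =
      contradiction (injective (here refl) (there x′∈) Rxt Rx′t′) (All.lookup x∉ x′∈)

module _ {a} {A : Set a} where

  links : List A → List (A × A)
  links []           = []
  links (x ∷ [])     = []
  links (x ∷ y ∷ xs) = (x , y) ∷ links (y ∷ xs)

  edges : List (List A) → List (A × A)
  edges = concatMap links

  -- orient o (y , x) ∈ edges xss says that x follows y (o = true) or precedes y (o = false).
  orient : Bool → A × A → A × A
  orient true  = id
  orient false = swap

  Linked⇒All-links : ∀ {r} {R : A → A → Set r} {xs} → Linked R xs → All (uncurry R) (links xs)
  Linked⇒All-links []             = []
  Linked⇒All-links [-]            = []
  Linked⇒All-links (Rxy ∷ linked) = Rxy ∷ Linked⇒All-links linked

  ∈-links⇒∈-edges : ∀ {e xs xss} → e ∈ links xs → xs ∈ xss → e ∈ edges xss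
  ∈-links⇒∈-edges e∈ xs∈ = ∈-concat⁺′ e∈ (∈-map⁺ links xs∈)

  crossingLink : ∀ {q r} {Q : Pred A q} {R : Pred A r} → (∀ y → Q y ⊎ R y) → ∀ {x xs} → Q x → Any R xs →
                 ∃₂ λ u v → (u , v) ∈ links (x ∷ xs) × Q u × R v
  crossingLink Q⊎R {x} {y ∷ _} Qx (here Ry) = x , y , here refl , Qx , Ry
  crossingLink Q⊎R {x} {y ∷ _} Qx (there some) with Q⊎R y
  ... | inj₂ Ry = x , y , here refl , Qx , Ry
  ... | inj₁ Qy with crossingLink Q⊎R Qy some
  ...   | u , v , uv∈ , Qu , Rv = u , v , there uv∈ , Qu , Rv

  map-proj₁-links⊆ : ∀ xs → map proj₁ (links xs) ⊆ xs
  map-proj₁-links⊆ []           = []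
  map-proj₁-links⊆ (x ∷ [])     = x ∷ʳ []
  map-proj₁-links⊆ (x ∷ y ∷ xs) = refl ∷ map-proj₁-links⊆ (y ∷ xs)

  map-proj₂-links⊆ : ∀ xs → map proj₂ (links xs) ⊆ xs
  map-proj₂-links⊆ []       = []
  map-proj₂-links⊆ (x ∷ xs) = x ∷ʳ tail⊆ x xs
    where
    tail⊆ : ∀ x xs → map proj₂ (links (x ∷ xs)) ⊆ xs
    tail⊆ x []       = []
    tail⊆ x (y ∷ xs) = refl ∷ tail⊆ y xs

  map-edges⊆ : (f : A × A → A) → (∀ xs → map f (links xs) ⊆ xs) → ∀ xss → map f (edges xss) ⊆ concat xss
  map-edges⊆ f links⊆ []         = []
  map-edges⊆ f links⊆ (xs ∷ xss) rewrite map-++ f (links xs) (edges xss) =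
    Sublist.++⁺ (links⊆ xs) (map-edges⊆ f links⊆ xss)

  module _ (xss : List (List A)) where

    orient-∈-edges⇒∈-concat : ∀ o {y x} → orient o (y , x) ∈ edges xss → x ∈ concat xss
    orient-∈-edges⇒∈-concat true  e∈ =
      Sublist.Any-resp-⊆ (map-edges⊆ proj₂ map-proj₂-links⊆ xss) (∈-map⁺ proj₂ e∈)
    orient-∈-edges⇒∈-concat false e∈ =
      Sublist.Any-resp-⊆ (map-edges⊆ proj₁ map-proj₁-links⊆ xss) (∈-map⁺ proj₁ e∈)

    orient-edge-unique : Unique (concat xss) → ∀ o {y x x′} →
                         orient o (y , x) ∈ edges xss → orient o (y , x′) ∈ edges xss → x ≡ x′
    orient-edge-unique unique true  e∈ e′∈ =
      cong proj₂ (Unique-map⇒injective (Unique-resp-⊆ (map-edges⊆ proj₁ map-proj₁-links⊆ xss) unique)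
                                        e∈ e′∈ refl)
    orient-edge-unique unique false e∈ e′∈ =
      cong proj₁ (Unique-map⇒injective (Unique-resp-⊆ (map-edges⊆ proj₂ map-proj₂-links⊆ xss) unique)
                                        e∈ e′∈ refl)

InRange : ℕ → ℕ → Set
InRange N a = 1 ≤ a × a ≤ N

∈-range1⇔ : ∀ {N x} → x ∈ range1 N ⇔ InRange N x
∈-range1⇔ {N} = mk⇔ to′ from′
  where
  to′ : ∀ {x} → x ∈ range1 N → InRange N x
  to′ x∈ with ∈-map⁻ suc x∈
  ... | i , i∈ , refl = s≤s z≤n , ∈-upTo⁻ i∈
  from′ : ∀ {x} → InRange N x → x ∈ range1 N
  from′ {suc i} (_ , x≤N) = ∈-map⁺ suc (∈-upTo⁺ x≤N)

Unique-range1 : ∀ N → Unique (range1 N)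
Unique-range1 N = Unique.map⁺ suc-injective (Unique.upTo⁺ N)

length-range1 : ∀ N → length (range1 N) ≡ N
length-range1 N = trans (length-map suc (upTo N)) (length-upTo N)

IsPartition⇒Unique-concat : ∀ {N A} → IsPartition N A → Unique (concat A)
IsPartition⇒Unique-concat (_ , A↭) = Unique-resp-↭ (↭-sym A↭) (Unique-range1 _)

module _ (n : ℕ) .{{_ : NonZero n}} where

  n*[N/n]≤N : ∀ N → n * (N / n) ≤ N
  n*[N/n]≤N N = subst (_≤ N) (*-comm (N / n) n) (m/n*n≤m N n)

  n*d/n≡d : ∀ d → n * d / n ≡ d
  n*d/n≡d d = trans (cong (_/ n) (*-comm n d)) (m*n/n≡m d n)

  InRange-scale⇔ : ∀ {N d} → InRange N (n * d) ⇔ InRange (N / n) d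
  InRange-scale⇔ {N} {d} = mk⇔
    (λ (1≤nd , nd≤N) → >-nonZero⁻¹ d {{m*n≢0⇒n≢0 n {{>-nonZero 1≤nd}}}} ,
                        subst (_≤ N / n) (n*d/n≡d d) (/-monoˡ-≤ n nd≤N))
    (λ (1≤d , d≤N/n) → *-mono-≤ (>-nonZero⁻¹ n) 1≤d , ≤-trans (*-monoʳ-≤ n d≤N/n) (n*[N/n]≤N N))

  Adj-scale⇔ : ∀ {a b} → Adj (n * a) (n * b) ⇔ Adj a b
  Adj-scale⇔ = mk⇔ (Sum.map (*-cancelˡ-∣ n) (*-cancelˡ-∣ n)) (Sum.map (*-monoʳ-∣ n) (*-monoʳ-∣ n))

  Unique-scale : ∀ {xs} → Unique xs → Unique (scale n xs)
  Unique-scale = Unique.map⁺ (*-cancelˡ-≡ _ _ n)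

  IsPath-scale⇔ : ∀ {N} D → IsPath N (scale n D) ⇔ IsPath (N / n) D
  IsPath-scale⇔ [] = mk⇔ (λ (nonempty , _) → contradiction refl nonempty)
                         (λ (nonempty , _) → contradiction refl nonempty)
  IsPath-scale⇔ (_ ∷ _) = mk⇔
    (λ (_ , unique , bounds , linked) → (λ ()) , Unique.map⁻ unique ,
       All.map (to InRange-scale⇔) (All.map⁻ bounds) , Linked.map (to Adj-scale⇔) (Linked.map⁻ linked))
    (λ (_ , unique , bounds , linked) → (λ ()) , Unique-scale unique ,
       All.map⁺ (All.map (from InRange-scale⇔) bounds) , Linked.map⁺ (Linked.map (from Adj-scale⇔) linked))

  scale-unscale : ∀ {xs} → All (n ∣_) xs → scale n (map (_/ n) xs) ≡ xs
  scale-unscale {xs} divisible = trans (sym (map-∘ xs)) (map-id-local (All.map m*[n/m]≡n divisible))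

  unscale-scale : ∀ xs → map (_/ n) (scale n xs) ≡ xs
  unscale-scale xs = trans (sym (map-∘ xs)) (map-id-local (All.tabulate λ {d} _ → n*d/n≡d d))

  scale-↭⁻ : ∀ {xs ys} → scale n xs ↭ scale n ys → xs ↭ ys
  scale-↭⁻ {xs} {ys} p = subst₂ _↭_ (unscale-scale xs) (unscale-scale ys) (Perm.map⁺ (_/ n) p)

  ∈-multiples⇔ : ∀ {N x} → x ∈ scale n (range1 (N / n)) ⇔ (x ∈ range1 N × n ∣ x)
  ∈-multiples⇔ {N} {x} = mk⇔ to′ from′
    where
    to′ : x ∈ scale n (range1 (N / n)) → x ∈ range1 N × n ∣ x
    to′ x∈ with ∈-map⁻ (n *_) x∈
    ... | d , d∈ , refl = from ∈-range1⇔ (from InRange-scale⇔ (to ∈-range1⇔ d∈)) , m∣m*n d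
    from′ : x ∈ range1 N × n ∣ x → x ∈ scale n (range1 (N / n))
    from′ (x∈ , n∣x) = subst (_∈ scale n (range1 (N / n))) n*[x/n]≡x
      (∈-map⁺ (n *_) (from ∈-range1⇔ (to InRange-scale⇔ (subst (InRange N) (sym n*[x/n]≡x) (to ∈-range1⇔ x∈)))))
      where n*[x/n]≡x = m*[n/m]≡n n∣x

  hasMultiple? : Decidable (Any (n ∣_))
  hasMultiple? P = any? (n ∣?_) P

  pathsWithoutMultiple : List (List ℕ) → List (List ℕ)
  pathsWithoutMultiple = filter (∁? hasMultiple?)

  module _ {A : List (List ℕ)} (factorizing : Factorizing A n) where

    private
      W = pathsWithMultiple n A

    pathsWithMultiple-divisible : All (All (n ∣_)) W
    pathsWithMultiple-divisible = All.tabulate λ P∈W →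
      let (P∈A , hasMultiple) = ∈-filter⁻ hasMultiple? P∈W in factorizing _ P∈A hasMultiple

    scale-unscale-paths : map (scale n) (map (map (_/ n)) W) ≡ W
    scale-unscale-paths = trans (sym (map-∘ W)) (map-id-local (All.map scale-unscale pathsWithMultiple-divisible))

    ∈-concat-pathsWithMultiple⇔ : ∀ {x} → x ∈ concat W ⇔ (x ∈ concat A × n ∣ x)
    ∈-concat-pathsWithMultiple⇔ {x} = mk⇔ to′ from′
      where
      to′ : x ∈ concat W → x ∈ concat A × n ∣ x
      to′ x∈ with ∈-concat⁻′ W x∈
      ... | P , x∈P , P∈W = ∈-concat⁺′ {xss = A} x∈P (proj₁ (∈-filter⁻ hasMultiple? P∈W)) ,
                            All.lookup (All.lookup pathsWithMultiple-divisible P∈W) x∈P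
      from′ : x ∈ concat A × n ∣ x → x ∈ concat W
      from′ (x∈ , n∣x) with ∈-concat⁻′ A x∈
      ... | P , x∈P , P∈A = ∈-concat⁺′ x∈P (∈-filter⁺ hasMultiple? P∈A (Any.map (λ { refl → n∣x }) x∈P))

  module _ {N A} (partition : IsPartition N A) (factorizing : Factorizing A n) where

    private
      W = pathsWithMultiple n A
      V = pathsWithoutMultiple A
      D = map (map (_/ n)) W

    concat-split-↭ : concat A ↭ concat W ++ concat V
    concat-split-↭ = ↭-trans (concat-↭ (filter-++-∁-↭ hasMultiple? A)) (↭-reflexive (sym (concat-++ W V)))

    concat-pathsWithMultiple-↭ : concat W ↭ scale n (range1 (N / n))
    concat-pathsWithMultiple-↭ = unique∧⇔⇒↭ uniqueW (Unique-scale (Unique-range1 (N / n))) sameMembers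
      where
      uniqueW : Unique (concat W)
      uniqueW = Unique-resp-⊆ (Sublist.++⁺ʳ (concat V) ⊆-refl)
                  (Unique-resp-↭ concat-split-↭ (IsPartition⇒Unique-concat partition))
      sameMembers : ∀ {x} → x ∈ concat W ⇔ x ∈ scale n (range1 (N / n))
      sameMembers = mk⇔
        (λ x∈W → let (x∈A , n∣x) = to ∈W⇔ x∈W in from ∈-multiples⇔ (Perm.∈-resp-↭ A↭ x∈A , n∣x))
        (λ x∈nk → let (x∈N , n∣x) = to ∈-multiples⇔ x∈nk in from ∈W⇔ (Perm.∈-resp-↭ (↭-sym A↭) x∈N , n∣x))
        where
        A↭ = proj₂ partition
        ∈W⇔ = ∈-concat-pathsWithMultiple⇔ factorizing

    unscaledPartition : IsPartition (N / n) D
    unscaledPartition = paths , scale-↭⁻ (subst (_↭ _) scaledConcat concat-pathsWithMultiple-↭)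
      where
      paths : All (IsPath (N / n)) D
      paths = All.map (to (IsPath-scale⇔ _)) (All.map⁻ (subst (All (IsPath N)) (sym (scale-unscale-paths factorizing))
                                                               (All.filter⁺ hasMultiple? (proj₁ partition))))
      scaledConcat : concat W ≡ scale n (concat D)
      scaledConcat = trans (cong concat (sym (scale-unscale-paths factorizing))) (concat-map D)

    rescaledPartition : ∀ {Q} → IsPartition (N / n) Q → IsPartition N (map (scale n) Q ++ V)
    rescaledPartition {Q} (pathsQ , Q↭) = paths , concat↭
      where
      paths : All (IsPath N) (map (scale n) Q ++ V)
      paths = All.++⁺ (All.map⁺ (All.map (from (IsPath-scale⇔ _)) pathsQ))
                      (All.filter⁺ (∁? hasMultiple?) (proj₁ partition))
      open PermutationReasoning
      concat↭ : concat (map (scale n) Q ++ V) ↭ range1 N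
      concat↭ = begin
        concat (map (scale n) Q ++ V)         ≡⟨ sym (concat-++ (map (scale n) Q) V) ⟩
        concat (map (scale n) Q) ++ concat V  ≡⟨ cong (_++ concat V) (concat-map Q) ⟩
        scale n (concat Q) ++ concat V        ↭⟨ Perm.++⁺ʳ (concat V) (Perm.map⁺ (n *_) Q↭) ⟩
        scale n (range1 (N / n)) ++ concat V  ↭⟨ Perm.++⁺ʳ (concat V) concat-pathsWithMultiple-↭ ⟨
        concat W ++ concat V                  ↭⟨ concat-split-↭ ⟨
        concat A                              ↭⟨ proj₂ partition ⟩
        range1 N                              ∎

  factorizing⇒quotientOptimal : ∀ {N A} → IsOptimal N A → Factorizing A n →
    Σ (List (List ℕ)) λ D → IsOptimal (N / n) D × (pathsWithMultiple n A ↭ map (scale n) D)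
  factorizing⇒quotientOptimal {N} {A} (partition , minimal) factorizing =
    D , (unscaledPartition partition factorizing , optimal) , ↭-reflexive (sym (scale-unscale-paths factorizing))
    where
    W = pathsWithMultiple n A
    V = pathsWithoutMultiple A
    D = map (map (_/ n)) W
    optimal : ∀ Q → IsPartition (N / n) Q → length D ≤ length Q
    optimal Q partitionQ = +-cancelʳ-≤ (length V) (length D) (length Q) (begin
      length D + length V                  ≡⟨ cong (_+ length V) (length-map (map (_/ n)) W) ⟩
      length W + length V                  ≡⟨ length-++ W ⟨
      length (W ++ V)                      ≡⟨ Perm.↭-length (filter-++-∁-↭ hasMultiple? A) ⟨
      length A                             ≤⟨ minimal _ (rescaledPartition partition factorizing partitionQ) ⟩
      length (map (scale n) Q ++ V)        ≡⟨ length-++ (map (scale n) Q) ⟩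
      length (map (scale n) Q) + length V  ≡⟨ cong (_+ length V) (length-map (scale n) Q) ⟩
      length Q + length V                  ∎)
      where open ≤-Reasoning

roughDivisorFrom : ∀ {m} d k → k + d ≡ m → d Rough m → ∃[ p ] d ≤ p × p ∣ m × p Rough m
roughDivisorFrom d zero refl rough = d , ≤-refl , ∣-refl , rough
roughDivisorFrom {m} d (suc k) k+d≡m rough with d ∣? m
... | yes d∣m = d , ≤-refl , d∣m , rough
... | no d∤m with roughDivisorFrom (suc d) k (trans (+-suc k d) k+d≡m) (∤⇒rough-suc d∤m rough)
...   | p , d<p , p∣m , roughP = p , ≤-trans (n≤1+n d) d<p , p∣m , roughP

leastDivisor : ∀ {m} → 2 ≤ m → ∃[ p ] 2 ≤ p × p ∣ m × p Rough m
leastDivisor 2≤m = roughDivisorFrom 2 _ (m∸n+n≡m 2≤m) 2-rough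

rough∧∣⇒≤ : ∀ {p m d} → p Rough m → 2 ≤ d → d ∣ m → p ≤ d
rough∧∣⇒≤ rough 2≤d d∣m = ≮⇒≥ λ d<p → rough (hasNonTrivialDivisor {{n>1⇒nonTrivial 2≤d}} d<p d∣m)

∣*∧∤⇒2≤gcd : ∀ {m t y} .{{_ : NonZero t}} → m ∣ t * y → ¬ m ∣ y → 2 ≤ gcd m t
∣*∧∤⇒2≤gcd {m} {t} m∣ty m∤y with gcd m t in eq
... | zero        = contradiction (gcd[m,n]≡0⇒n≡0 m eq) (≢-nonZero⁻¹ t)
... | suc zero    = contradiction (coprime-divisor (gcd≡1⇒coprime eq) m∣ty) m∤y
... | suc (suc _) = s≤s (s≤s z≤n)

divisor-positive : ∀ {x y} → y ∣ x → 1 ≤ x → 1 ≤ y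
divisor-positive {y = zero}  y∣x 1≤x = contradiction (0∣⇒≡0 y∣x) (≢-nonZero⁻¹ _ {{>-nonZero 1≤x}})
divisor-positive {y = suc _} _   _   = s≤s z≤n

-- With z = zn / zd, for m ≥ 2 this says P⁻(m) > z.
RoughAbove : ℕ → ℕ → ℕ → Set
RoughAbove zn zd m = ∀ d → 2 ≤ d → d ∣ m → zn < d * zd

module _ {zn zd : ℕ} where

  smallestPrimeFactor⇒RoughAbove : ∀ {m} → 2 ≤ m → (∀ p → SmallestPrimeFactor m p → zn < p * zd) →
                                   RoughAbove zn zd m
  smallestPrimeFactor⇒RoughAbove 2≤m bound d 2≤d d∣m with leastDivisor 2≤m
  ... | p , 2≤p , p∣m , rough =
    <-≤-trans (bound p (prime , p∣m , least)) (*-monoˡ-≤ zd (rough∧∣⇒≤ rough 2≤d d∣m))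
    where
    prime = rough∧∣⇒prime {{n>1⇒nonTrivial 2≤p}} rough p∣m
    least = λ q q-prime q∣m → rough∧∣⇒≤ rough (nonTrivial⇒n>1 q {{prime⇒nonTrivial q-prime}}) q∣m

  RoughAbove⇒cofactor> : ∀ {m t y} → RoughAbove zn zd m → .{{_ : NonZero t}} →
                         m ∣ t * y → ¬ m ∣ y → zn < t * zd
  RoughAbove⇒cofactor> {m} {t} rough m∣ty m∤y =
    <-≤-trans (rough (gcd m t) (∣*∧∤⇒2≤gcd m∣ty m∤y) (gcd[m,n]∣m m t))
              (*-monoˡ-≤ zd (∣⇒≤ (gcd[m,n]∣n m t)))

  RoughAbove⇒nonMultipleDivisor< : ∀ {m x y} → RoughAbove zn zd m → m ∣ x → y ∣ x → ¬ m ∣ y → 1 ≤ x →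
                                   y * zn < x * zd
  RoughAbove⇒nonMultipleDivisor< {y = y} rough m∣x (divides t refl) m∤y 1≤ty = begin-strict
    y * zn        <⟨ *-monoʳ-< y {{m*n≢0⇒n≢0 t {{ty≢0}}}} zn<t*zd ⟩
    y * (t * zd)  ≡⟨ *-assoc y t zd ⟨
    y * t * zd    ≡⟨ cong (_* zd) (*-comm y t) ⟩
    t * y * zd    ∎
    where
    open ≤-Reasoning
    ty≢0 = >-nonZero 1≤ty
    zn<t*zd = RoughAbove⇒cofactor> rough {{m*n≢0⇒m≢0 t {{ty≢0}}}} m∣x m∤y

  RoughAbove⇒∣largeDivisor : ∀ {m m′ x} → RoughAbove zn zd m′ → m ∣ x → m′ ∣ x → 1 ≤ x →
                             x * zd < m * zn → m′ ∣ m
  RoughAbove⇒∣largeDivisor {m} {m′} rough (divides j refl) m′∣x 1≤jm large with m′ ∣? m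
  ... | yes m′∣m = m′∣m
  ... | no m′∤m = contradiction zn<j*zd (<-asym j*zd<zn)
    where
    open ≤-Reasoning
    zn<j*zd = RoughAbove⇒cofactor> rough {{m*n≢0⇒m≢0 j {{>-nonZero 1≤jm}}}} m′∣x m′∤m
    j*zd<zn : j * zd < zn
    j*zd<zn = *-cancelʳ-< m (j * zd) zn (begin-strict
      j * zd * m    ≡⟨ *-assoc j zd m ⟩
      j * (zd * m)  ≡⟨ cong (j *_) (*-comm zd m) ⟩
      j * (m * zd)  ≡⟨ *-assoc j m zd ⟨
      j * m * zd    <⟨ large ⟩
      m * zn        ≡⟨ *-comm m zn ⟩
      zn * m        ∎)

  largeRoughDivisor-unique : ∀ {m m′ x} → RoughAbove zn zd m → RoughAbove zn zd m′ → m ∣ x → m′ ∣ x → 1 ≤ x →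
                             x * zd < m * zn → x * zd < m′ * zn → m ≡ m′
  largeRoughDivisor-unique rough rough′ m∣x m′∣x 1≤x large large′ =
    ∣-antisym (RoughAbove⇒∣largeDivisor rough m′∣x m∣x 1≤x large′)
              (RoughAbove⇒∣largeDivisor rough′ m∣x m′∣x 1≤x large)

module _ {a d : ℕ} .{{_ : NonZero d}} where

  *<⇒≤pred/ : ∀ {y} → y * d < a → y ≤ pred a / d
  *<⇒≤pred/ {y} y*d<a = subst (_≤ pred a / d) (m*n/n≡m y d) (/-monoˡ-≤ d (<⇒≤pred y*d<a))

  pred/*< : .{{_ : NonZero a}} → pred a / d * d < a
  pred/*< = m≤pred[n]⇒suc[m]≤n (m/n*n≤m (pred a) d)

factorizable? : ∀ m → Decidable (λ P → Any (m ∣_) P → All (m ∣_) P)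
factorizable? m P = any? (m ∣?_) P →-dec All.all? (m ∣?_) P

¬Factorizing⇒mixedPath : ∀ {A m} → ¬ Factorizing A m → ∃[ P ] P ∈ A × Any (m ∣_) P × Any (∁ (m ∣_)) P
¬Factorizing⇒mixedPath {A} {m} ¬factorizing with All.all? (factorizable? m) A
... | yes factorizing = contradiction (λ _ P∈A → All.lookup factorizing P∈A) ¬factorizing
... | no ¬all with find (¬All⇒Any¬ (factorizable? m) A ¬all)
...   | P , P∈A , ¬factorizable with any? (m ∣?_) P
...     | yes multiple = P , P∈A , multiple , ¬All⇒Any¬ (m ∣?_) P (λ all → ¬factorizable (const all))
...     | no ¬multiple = contradiction (λ multiple → contradiction multiple ¬multiple) ¬factorizable

Adj-towardsMultiple : ∀ {m x y} → Adj y x → m ∣ x → ¬ m ∣ y → y ∣ x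
Adj-towardsMultiple (inj₁ y∣x) _   _   = y∣x
Adj-towardsMultiple (inj₂ x∣y) m∣x m∤y = contradiction (∣-trans m∣x x∣y) m∤y

mixedPath⇒nonMultipleNeighbour : ∀ {m P} → Linked Adj P → Any (m ∣_) P → Any (∁ (m ∣_)) P →
  ∃₂ λ o y → ∃[ x ] orient o (y , x) ∈ links P × m ∣ x × y ∣ x × ¬ m ∣ y
mixedPath⇒nonMultipleNeighbour {m} {a ∷ _} linked multiple nonMultiple with m ∣? a
... | yes m∣a =
  let (x , y , xy∈ , m∣x , m∤y) =
        crossingLink (toSum ∘ (m ∣?_)) m∣a (Any.tail (λ m∤a → m∤a m∣a) nonMultiple)
      adj = All.lookup (Linked⇒All-links linked) xy∈
  in false , y , x , xy∈ , m∣x , Adj-towardsMultiple (Sum.swap adj) m∣x m∤y , m∤y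
... | no m∤a =
  let (y , x , yx∈ , m∤y , m∣x) = crossingLink (Sum.swap ∘ toSum ∘ (m ∣?_)) m∤a (Any.tail m∤a multiple)
      adj = All.lookup (Linked⇒All-links linked) yx∈
  in true , y , x , yx∈ , m∣x , Adj-towardsMultiple adj m∣x m∤y , m∤y

InM⇒RoughAbove : ∀ {N A zn zd m} → InM N A zn zd m → RoughAbove zn zd m
InM⇒RoughAbove (_ , _ , _ , 2≤m , smallestPrime) = smallestPrimeFactor⇒RoughAbove 2≤m smallestPrime

module _ {N : ℕ} {A : List (List ℕ)} {zn zd : ℕ} (partition : IsPartition N A) .{{_ : NonZero zn}} where

  NeighbourOf : ℕ → ℕ × Bool → Set
  NeighbourOf m (y , o) = ∃[ x ] orient o (y , x) ∈ edges A × m ∣ x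

  private
    -- the largest y with y * zn < N * zd, i.e. y < N / z
    c = pred (N * zd) / zn
    targets = map (_, true) (range1 c) ++ map (_, false) (range1 c)

  ∈-targets : ∀ {y} o → InRange c y → (y , o) ∈ targets
  ∈-targets true  y∈ = ∈-++⁺ˡ (∈-map⁺ (_, true) (from ∈-range1⇔ y∈))
  ∈-targets false y∈ = ∈-++⁺ʳ (map (_, true) (range1 c)) (∈-map⁺ (_, false) (from ∈-range1⇔ y∈))

  length-targets : length targets ≡ c + c
  length-targets =
    trans (length-++ (map (_, true) (range1 c))) (cong₂ _+_ (length-tagged true) (length-tagged false))
    where
    length-tagged : ∀ o → length (map (_, o) (range1 c)) ≡ c
    length-tagged o = trans (length-map (_, o) (range1 c)) (length-range1 c)

  edge-InRange : ∀ o {y x} → orient o (y , x) ∈ edges A → InRange N x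
  edge-InRange o e∈ = to ∈-range1⇔ (Perm.∈-resp-↭ (proj₂ partition) (orient-∈-edges⇒∈-concat A o e∈))

  ∈-partition⇒Linked : ∀ {P} → P ∈ A → Linked Adj P
  ∈-partition⇒Linked P∈A = let (_ , _ , _ , linked) = All.lookup (proj₁ partition) P∈A in linked

  InM⇒neighbour : ∀ {m} → InM N A zn zd m → ∃[ t ] t ∈ targets × NeighbourOf m t
  InM⇒neighbour inM@(_ , ¬factorizing , _) with ¬Factorizing⇒mixedPath ¬factorizing
  ... | P , P∈A , multiple , nonMultiple
    with mixedPath⇒nonMultipleNeighbour (∈-partition⇒Linked P∈A) multiple nonMultiple
  ... | o , y , x , link , m∣x , y∣x , m∤y =
    let edge = ∈-links⇒∈-edges link P∈A
        (1≤x , x≤N) = edge-InRange o edge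
        y*zn<x*zd = RoughAbove⇒nonMultipleDivisor< (InM⇒RoughAbove inM) m∣x y∣x m∤y 1≤x
        y*zn<N*zd = <-≤-trans y*zn<x*zd (*-monoˡ-≤ zd x≤N)
    in (y , o) , ∈-targets o (divisor-positive y∣x 1≤x , *<⇒≤pred/ y*zn<N*zd) , x , edge , m∣x

  neighbour-injective : ∀ {m m′} t → InM N A zn zd m → InM N A zn zd m′ →
                        NeighbourOf m t → NeighbourOf m′ t → m ≡ m′
  neighbour-injective (y , o) inM@(_ , _ , large , _) inM′@(_ , _ , large′ , _)
                      (x , edge , m∣x) (x′ , edge′ , m′∣x′)
    with refl ← orient-edge-unique A (IsPartition⇒Unique-concat partition) o edge edge′ =
    let (1≤x , x≤N) = edge-InRange o edge
        x*zd≤N*zd = *-monoˡ-≤ zd x≤N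
    in largeRoughDivisor-unique (InM⇒RoughAbove inM) (InM⇒RoughAbove inM′) m∣x m′∣x′ 1≤x
         (≤-<-trans x*zd≤N*zd large) (≤-<-trans x*zd≤N*zd large′)

  length-M*zn<2*N*zd : 1 ≤ N → 1 ≤ zd → ∀ {M} → Unique M → (∀ m → m ∈ M ⇔ InM N A zn zd m) →
                       length M * zn < 2 * N * zd
  length-M*zn<2*N*zd 1≤N 1≤zd {M} unique M⇔ = begin-strict
    length M * zn    ≤⟨ *-monoˡ-≤ zn (subst (length M ≤_) length-targets |M|≤|targets|) ⟩
    (c + c) * zn     ≡⟨ *-distribʳ-+ zn c c ⟩
    c * zn + c * zn  <⟨ +-mono-< c*zn<N*zd c*zn<N*zd ⟩
    N * zd + N * zd  ≡⟨ cong (N * zd +_) (+-identityʳ (N * zd)) ⟨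
    2 * (N * zd)     ≡⟨ *-assoc 2 N zd ⟨
    2 * N * zd       ∎
    where
    open ≤-Reasoning
    |M|≤|targets| : length M ≤ length targets
    |M|≤|targets| = pigeonhole NeighbourOf unique (λ {m} m∈ → InM⇒neighbour (to (M⇔ m) m∈))
                      (λ {m} {m′} {t} m∈ m′∈ → neighbour-injective t (to (M⇔ m) m∈) (to (M⇔ m′) m′∈))
    c*zn<N*zd : c * zn < N * zd
    c*zn<N*zd = pred/*< {N * zd} {zn} {{_}} {{m*n≢0 N zd {{>-nonZero 1≤N}} {{>-nonZero 1≤zd}}}}

lemma1 : (N : ℕ) → 1 ≤ N → (A : List (List ℕ)) → IsOptimal N A →
    ((n : ℕ) .{{_ : NonZero n}} → n ≤ N → Factorizing A n →
      Σ (List (List ℕ)) (λ D → IsOptimal (N / n) D ×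
        (pathsWithMultiple n A ↭ map (scale n) D)))
    ×
    ((zn zd : ℕ) → 1 ≤ zd → zd < zn →
      (M : List ℕ) → Unique M → (∀ m → m ∈ M ⇔ InM N A zn zd m) →
      length M * zn < 2 * N * zd)
lemma1 N 1≤N A optimal =
  -- part (i) holds without n ≤ N (for n > N both sides are empty)
  (λ n _ factorizing → factorizing⇒quotientOptimal n optimal factorizing) ,
  (λ zn zd 1≤zd zd<zn M unique M⇔ →
     length-M*zn<2*N*zd (proj₁ optimal) {{>-nonZero (≤-<-trans z≤n zd<zn)}} 1≤N 1≤zd unique M⇔)
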